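{- For every molecule $\mathcal{M}$: $\mathcal{M}$ is derivable in the natural deduction system $\mathrm{ISL}$ if and only if $\mathcal{M}$ is derivable in the sequent calculus $\mathrm{ISC}$.
   Context: Formulas are generated by $\sigma ::= a \mid \sigma\to\sigma \mid \sigma\wedge\sigma \mid \sigma\cap\sigma$, where $a$ ranges over a countable set of propositional variables ($\wedge$ is the "global" conjunction, $\cap$ the "local" conjunction/intersection). A context is a finite sequence of formulas. An atom $(\Gamma;\sigma)$ is a pair of a context and a formula. A molecule is a finite multiset of atoms all of whose contexts have the same length; we write $[(\Gamma_i;\sigma_i)\mid i\in I]$ or $[(\Gamma_i;\sigma_i)]_i$, and $\cup$ denotes multiset union. Commas in contexts denote concatenation. In "global" rules all molecules are indexed by the same finite set $I$. The system $\mathrm{ISL}$ has the rules (from premise(s) infer conclusion): (Ax) $[(\sigma_i;\sigma_i)]_i$ with no premise. (P) from $\mathcal{M}\cup\mathcal{N}$ infer $\mathcal{M}$. (W) from $[(\Gamma_i;\tau_i)]_i$ infer $[(\Gamma_i,\sigma_i;\tau_i)]_i$. (X) from $[(\Gamma^i_1,\tau_i,\sigma_i,\Gamma^i_2;\rho_i)]_i$ infer $[(\Gamma^i_1,\sigma_i,\tau_i,\Gamma^i_2;\rho_i)]_i$. ($\to$I) from $[(\Gamma_i,\sigma_i;\tau_i)]_i$ infer $[(\Gamma_i;\sigma_i\to\tau_i)]_i$. ($\to$E) from $[(\Gamma_i;\sigma_i\to\tau_i)]_i$ and $[(\Gamma_i;\sigma_i)]_i$ infer $[(\Gamma_i;\tau_i)]_i$.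 ($\wedge$I) from $[(\Gamma_i;\sigma_i)]_i$ and $[(\Gamma_i;\tau_i)]_i$ infer $[(\Gamma_i;\sigma_i\wedge\tau_i)]_i$. ($\wedge$E$_k$), $k\in\{L,R\}$: from $[(\Gamma_i;\sigma^L_i\wedge\sigma^R_i)]_i$ infer $[(\Gamma_i;\sigma^k_i)]_i$. ($\cap$I) from $\mathcal{M}\cup[(\Gamma;\sigma),(\Gamma;\tau)]$ infer $\mathcal{M}\cup[(\Gamma;\sigma\cap\tau)]$. ($\cap$E$_k$), $k\in\{L,R\}$: from $\mathcal{M}\cup[(\Gamma;\sigma_L\cap\sigma_R)]$ infer $\mathcal{M}\cup[(\Gamma;\sigma_k)]$. The system $\mathrm{ISC}$ has the rules: (Ax) $[(\alpha_i;\alpha_i)\mid i\in I]$ with no premise. (cut) from $[(\Gamma_i;\alpha_i)]_i$ and $[(\Delta_i,\alpha_i;\beta_i)]_i$ infer $[(\Gamma_i,\Delta_i;\beta_i)]_i$. (W) from $[(\Gamma_i;\beta_i)]_i$ infer $[(\Gamma_i,\alpha_i;\beta_i)]_i$. (X) from $[(\Gamma_i,\beta_i,\alpha_i,\Delta_i;\gamma_i)]_i$ infer $[(\Gamma_i,\alpha_i,\beta_i,\Delta_i;\gamma_i)]_i$. (C) from $[(\Gamma_i,\alpha_i,\alpha_i;\beta_i)]_i$ infer $[(\Gamma_i,\alpha_i;\beta_i)]_i$. (Fus) from $[(\Gamma;\beta)]\cup\mathcal{M}$ infer $[(\Gamma;\beta),(\Gamma;\beta)]\cup\mathcal{M}$.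 (P) from $\mathcal{M}\cup\mathcal{N}$ infer $\mathcal{M}$. ($\to$L) from $[(\Gamma_i;\alpha_i)]_i$ and $[(\Delta_i,\beta_i;\gamma_i)]_i$ infer $[(\Gamma_i,\Delta_i,\alpha_i\to\beta_i;\gamma_i)]_i$. ($\to$R) from $[(\Gamma_i,\alpha_i;\beta_i)]_i$ infer $[(\Gamma_i;\alpha_i\to\beta_i)]_i$. ($\wedge$L) from $[(\Gamma_i,\alpha^L_i,\alpha^R_i;\beta_i)]_i$ infer $[(\Gamma_i,\alpha^L_i\wedge\alpha^R_i;\beta_i)]_i$. ($\wedge$R) from $[(\Gamma_i;\alpha_i)]_i$ and $[(\Delta_i;\beta_i)]_i$ infer $[(\Gamma_i,\Delta_i;\alpha_i\wedge\beta_i)]_i$. ($\cap$L$_k$), $k\in\{L,R\}$: from $[(\Gamma,\alpha_k;\beta)]\cup\mathcal{M}$ infer $[(\Gamma,\alpha_L\cap\alpha_R;\beta)]\cup\mathcal{M}$. ($\cap$R) from $[(\Gamma;\alpha),(\Gamma;\beta)]\cup\mathcal{M}$ infer $[(\Gamma;\alpha\cap\beta)]\cup\mathcal{M}$. -}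

module Defs where

open import Data.Nat using (ℕ)
open import Data.List using (List; []; _∷_; [_]; _++_; map; length)
open import Data.List.Membership.Propositional using (_∈_)
open import Data.List.Relation.Binary.Permutation.Propositional using (_↭_)
open import Data.Product using (_×_; _,_)
open import Relation.Binary.PropositionalEquality using (_≡_)

infixr 6 _⇒_
infixr 7 _∧_ _∩_

data Formula : Set where
  var : ℕ → Formula
  _⇒_ : Formula → Formula → Formula
  _∧_ : Formula → Formula → Formula
  _∩_ : Formula → Formula → Formula

-- A context is a finite sequence of formulas; "Γ , σ" is Γ ++ [ σ ].
Context : Set
Context = List Formula

Atom : Set
Atom = Context × Formula

-- Finite multisets of atoms are represented by lists; every derivability
-- predicate below is closed under permutation (rule P with N = []),
-- so it only depends on the underlying multiset.
AtomList : Set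
AtomList = List Atom

IsMolecule : AtomList → Set
IsMolecule M = ∀ {A B} → A ∈ M → B ∈ M →
  length (Data.Product.proj₁ A) ≡ length (Data.Product.proj₁ B)

-- Natural deduction system ISL.  Global rules are indexed by a finite
-- index set I, represented as a list of tuples (one per i ∈ I).

data ISL : AtomList → Set where
  ax : (σs : List Formula) → ISL (map (λ σ → [ σ ] , σ) σs)
  P : ∀ {L} (M N : AtomList) → L ↭ M ++ N → ISL L → ISL M
  W : (xs : List (Context × Formula × Formula)) →
      ISL (map (λ { (Γ , σ , τ) → Γ , τ }) xs) →
      ISL (map (λ { (Γ , σ , τ) → Γ ++ [ σ ] , τ }) xs)
  X : (xs : List (Context × Formula × Formula × Context × Formula)) →
      ISL (map (λ { (Γ₁ , τ , σ , Γ₂ , ρ) → Γ₁ ++ τ ∷ σ ∷ Γ₂ , ρ }) xs) →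
      ISL (map (λ { (Γ₁ , τ , σ , Γ₂ , ρ) → Γ₁ ++ σ ∷ τ ∷ Γ₂ , ρ }) xs)
  ⇒I : (xs : List (Context × Formula × Formula)) →
       ISL (map (λ { (Γ , σ , τ) → Γ ++ [ σ ] , τ }) xs) →
       ISL (map (λ { (Γ , σ , τ) → Γ , σ ⇒ τ }) xs)
  ⇒E : (xs : List (Context × Formula × Formula)) →
       ISL (map (λ { (Γ , σ , τ) → Γ , σ ⇒ τ }) xs) →
       ISL (map (λ { (Γ , σ , τ) → Γ , σ }) xs) →
       ISL (map (λ { (Γ , σ , τ) → Γ , τ }) xs)
  ∧I : (xs : List (Context × Formula × Formula)) →
       ISL (map (λ { (Γ , σ , τ) → Γ , σ }) xs) →
       ISL (map (λ { (Γ , σ , τ) → Γ , τ }) xs) →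
       ISL (map (λ { (Γ , σ , τ) → Γ , σ ∧ τ }) xs)
  ∧EL : (xs : List (Context × Formula × Formula)) →
        ISL (map (λ { (Γ , σL , σR) → Γ , σL ∧ σR }) xs) →
        ISL (map (λ { (Γ , σL , σR) → Γ , σL }) xs)
  ∧ER : (xs : List (Context × Formula × Formula)) →
        ISL (map (λ { (Γ , σL , σR) → Γ , σL ∧ σR }) xs) →
        ISL (map (λ { (Γ , σL , σR) → Γ , σR }) xs)
  ∩I : (M : AtomList) (Γ : Context) (σ τ : Formula) →
       ISL (M ++ (Γ , σ) ∷ (Γ , τ) ∷ []) →
       ISL (M ++ [ Γ , σ ∩ τ ])
  ∩EL : (M : AtomList) (Γ : Context) (σL σR : Formula) →
        ISL (M ++ [ Γ , σL ∩ σR ]) →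
        ISL (M ++ [ Γ , σL ])
  ∩ER : (M : AtomList) (Γ : Context) (σL σR : Formula) →
        ISL (M ++ [ Γ , σL ∩ σR ]) →
        ISL (M ++ [ Γ , σR ])

data ISC : AtomList → Set where
  ax : (αs : List Formula) → ISC (map (λ α → [ α ] , α) αs)
  cut : (xs : List (Context × Context × Formula × Formula)) →
        ISC (map (λ { (Γ , Δ , α , β) → Γ , α }) xs) →
        ISC (map (λ { (Γ , Δ , α , β) → Δ ++ [ α ] , β }) xs) →
        ISC (map (λ { (Γ , Δ , α , β) → Γ ++ Δ , β }) xs)
  W : (xs : List (Context × Formula × Formula)) →
      ISC (map (λ { (Γ , α , β) → Γ , β }) xs) →
      ISC (map (λ { (Γ , α , β) → Γ ++ [ α ] , β }) xs)
  X : (xs : List (Context × Formula × Formula × Context × Formula)) →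
      ISC (map (λ { (Γ , β , α , Δ , γ) → Γ ++ β ∷ α ∷ Δ , γ }) xs) →
      ISC (map (λ { (Γ , β , α , Δ , γ) → Γ ++ α ∷ β ∷ Δ , γ }) xs)
  C : (xs : List (Context × Formula × Formula)) →
      ISC (map (λ { (Γ , α , β) → Γ ++ α ∷ α ∷ [] , β }) xs) →
      ISC (map (λ { (Γ , α , β) → Γ ++ [ α ] , β }) xs)
  Fus : (M : AtomList) (Γ : Context) (β : Formula) →
        ISC (M ++ [ Γ , β ]) →
        ISC (M ++ (Γ , β) ∷ (Γ , β) ∷ [])
  P : ∀ {L} (M N : AtomList) → L ↭ M ++ N → ISC L → ISC M
  ⇒L : (xs : List (Context × Context × Formula × Formula × Formula)) →
       ISC (map (λ { (Γ , Δ , α , β , γ) → Γ , α }) xs) →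
       ISC (map (λ { (Γ , Δ , α , β , γ) → Δ ++ [ β ] , γ }) xs) →
       ISC (map (λ { (Γ , Δ , α , β , γ) → Γ ++ Δ ++ [ α ⇒ β ] , γ }) xs)
  ⇒R : (xs : List (Context × Formula × Formula)) →
       ISC (map (λ { (Γ , α , β) → Γ ++ [ α ] , β }) xs) →
       ISC (map (λ { (Γ , α , β) → Γ , α ⇒ β }) xs)
  ∧L : (xs : List (Context × Formula × Formula × Formula)) →
       ISC (map (λ { (Γ , αL , αR , β) → Γ ++ αL ∷ αR ∷ [] , β }) xs) →
       ISC (map (λ { (Γ , αL , αR , β) → Γ ++ [ αL ∧ αR ] , β }) xs)
  ∧R : (xs : List (Context × Context × Formula × Formula)) →
       ISC (map (λ { (Γ , Δ , α , β) → Γ , α }) xs) →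
       ISC (map (λ { (Γ , Δ , α , β) → Δ , β }) xs) →
       ISC (map (λ { (Γ , Δ , α , β) → Γ ++ Δ , α ∧ β }) xs)
  ∩LL : (M : AtomList) (Γ : Context) (αL αR β : Formula) →
        ISC (M ++ [ Γ ++ [ αL ] , β ]) →
        ISC (M ++ [ Γ ++ [ αL ∩ αR ] , β ])
  ∩LR : (M : AtomList) (Γ : Context) (αL αR β : Formula) →
        ISC (M ++ [ Γ ++ [ αR ] , β ]) →
        ISC (M ++ [ Γ ++ [ αL ∩ αR ] , β ])
  ∩R : (M : AtomList) (Γ : Context) (α β : Formula) →
       ISC (M ++ (Γ , α) ∷ (Γ , β) ∷ []) →
       ISC (M ++ [ Γ , α ∩ β ])

module Submission where

-- Each system simulates the other rule by rule.  A molecule whose contexts all have length n is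
-- the same thing as a single context of n formula families, and on such contexts the global rules
-- behave exactly like the ordinary rules on one sequent.  Every ISL-derivable multiset has contexts
-- of a common length, so this transposition is always available.
--
-- In ISL, cut, contraction, ⇒L, ∧L and ∧R are instances of substitution: close all hypotheses
-- with ⇒I, weaken into the new context, and discharge them again with ⇒E against derivations of
-- them.  The local rule ∩L is the same manoeuvre on the last hypothesis alone, fed by ∩E applied
-- to an assumption.  Fusion is admissible because a derivation of L can be run twice side by side,
-- giving L ∪ L.  In ISC, ⇒E on a shared context goes by induction on the context with the
-- S combinator, and ∧I, ∧E, ∩E are cuts against small closed derivations.

open import Defs
open import Data.Nat using (ℕ; zero; suc; _+_; _∸_)
open import Data.Nat.Properties using (m+n∸n≡m)
open import Data.List using (List; []; _∷_; [_]; _++_; map; length; foldr; drop; InitLast; _∷ʳ′_; initLast)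
open import Data.List.Properties
  using (map-++; map-∘; map-cong-local; map-cong; map-id; length-++; length-map; length-drop;
         ++-assoc; ++-identityʳ; ++-conicalʳ; ∷ʳ-injective)
open import Data.List.Reverse using (Reverse; []; _∶_∶ʳ_; reverseView)
open import Data.List.Relation.Unary.All as All using (All; []; _∷_)
open import Data.List.Relation.Unary.All.Properties using (map⁺; map⁻; ++⁺; ++⁻ˡ; ++⁻ʳ)
open import Data.List.Relation.Unary.Any using (here)
open import Data.List.Membership.Propositional using (_∈_)
open import Data.List.Membership.Propositional.Properties using (∈-∃++; ∈-++⁺ˡ; ∈-++⁺ʳ)
open import Data.List.Relation.Binary.Subset.Propositional using (_⊆_)
open import Data.List.Relation.Binary.Subset.Propositional.Properties as ⊆
  using (⊆-refl; ∈-∷⁺ʳ; xs⊆xs++ys; xs⊆ys++xs)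
open import Data.List.Relation.Binary.Permutation.Propositional using (_↭_; ↭-trans; ↭-sym; ↭-reflexive)
open import Data.List.Relation.Binary.Permutation.Propositional.Properties as Perm using (All-resp-↭)
open import Data.Maybe using (Maybe; just; nothing)
open import Data.Product using (_×_; _,_; proj₁; proj₂; ∃-syntax)
open import Function using (_∘_)
open import Relation.Binary.PropositionalEquality using (_≡_; refl; sym; trans; cong; cong₂; subst)

length-++⁻ : ∀ (Γ E : Context) {n} → length (Γ ++ E) ≡ n → length Γ ≡ n ∸ length E
length-++⁻ Γ E refl = sym (trans (cong (_∸ length E) (length-++ Γ)) (m+n∸n≡m (length Γ) (length E)))

map-∘-∷ʳ : ∀ {A B C : Set} (f : B → C) (g : A → B) xs z →
           map f (map g xs ++ [ z ]) ≡ map (f ∘ g) xs ++ [ f z ]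
map-∘-∷ʳ f g xs z = trans (map-++ f (map g xs) [ z ]) (cong (_++ [ f z ]) (sym (map-∘ xs)))

ContextLength : ℕ → AtomList → Set
ContextLength n = All (λ a → length (proj₁ a) ≡ n)

ContextLength-map : ∀ {X : Set} {f g : X → Atom} {xs m n} →
                    (∀ x → length (proj₁ (f x)) ≡ m → length (proj₁ (g x)) ≡ n) →
                    ContextLength m (map f xs) → ContextLength n (map g xs)
ContextLength-map h u = map⁺ (All.map (λ {x} → h x) (map⁻ u))

ISL-uniform : ∀ {L} → ISL L → ∃[ n ] ContextLength n L
ISL-uniform (ax σs) = 1 , map⁺ (All.universal (λ _ → refl) σs)
ISL-uniform (P M N p d) with n , u ← ISL-uniform d = n , ++⁻ˡ M (All-resp-↭ p u)
ISL-uniform (W xs d) with n , u ← ISL-uniform d =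
  n + 1 , ContextLength-map (λ (Γ , _) e → trans (length-++ Γ) (cong (_+ 1) e)) u
ISL-uniform (X xs d) with n , u ← ISL-uniform d =
  n , ContextLength-map (λ (Γ₁ , _) e → trans (length-++ Γ₁) (trans (sym (length-++ Γ₁)) e)) u
ISL-uniform (⇒I xs d) with n , u ← ISL-uniform d =
  n ∸ 1 , ContextLength-map (λ (Γ , _) → length-++⁻ Γ _) u
ISL-uniform (⇒E xs d _) with n , u ← ISL-uniform d = n , ContextLength-map (λ _ e → e) u
ISL-uniform (∧I xs d _) with n , u ← ISL-uniform d = n , ContextLength-map (λ _ e → e) u
ISL-uniform (∧EL xs d) with n , u ← ISL-uniform d = n , ContextLength-map (λ _ e → e) u
ISL-uniform (∧ER xs d) with n , u ← ISL-uniform d = n , ContextLength-map (λ _ e → e) u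
ISL-uniform (∩I M _ _ _ d) with n , u ← ISL-uniform d = n , ++⁺ (++⁻ˡ M u) (All.head (++⁻ʳ M u) ∷ [])
ISL-uniform (∩EL M _ _ _ d) with n , u ← ISL-uniform d = n , ++⁺ (++⁻ˡ M u) (All.head (++⁻ʳ M u) ∷ [])
ISL-uniform (∩ER M _ _ _ d) with n , u ← ISL-uniform d = n , ++⁺ (++⁻ˡ M u) (All.head (++⁻ʳ M u) ∷ [])

-- The junk value `var 0` is never observed: contexts are only transposed up to their length.
head₀ : Context → Formula
head₀ []      = var 0
head₀ (φ ∷ _) = φ

-- Contexts are transposed: a family over ys of contexts of common length n is a list of n formula
-- families, so the molecules with contexts of a common length are exactly those of the form G ⊢ φ.
module Family {Y : Set} (ys : List Y) where

  ⟦_⟧ : List (Y → Formula) → Y → Context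
  ⟦ G ⟧ y = map (λ g → g y) G

  ⟦⟧-++ : ∀ G H y → ⟦ G ++ H ⟧ y ≡ ⟦ G ⟧ y ++ ⟦ H ⟧ y
  ⟦⟧-++ G H y = map-++ (λ g → g y) G H

  infix 4 _⊢_
  _⊢_ : List (Y → Formula) → (Y → Formula) → AtomList
  G ⊢ φ = map (λ y → ⟦ G ⟧ y , φ y) ys

  infixr 6 _⇒̇_
  infixr 7 _∧̇_
  _⇒̇_ _∧̇_ : (Y → Formula) → (Y → Formula) → Y → Formula
  (σ ⇒̇ τ) y = σ y ⇒ τ y
  (σ ∧̇ τ) y = σ y ∧ τ y

  infix 4 _≈_
  _≈_ : List (Y → Formula) → (Y → Context) → Set
  G ≈ Γ = All (λ y → ⟦ G ⟧ y ≡ Γ y) ys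

  ≈-refl : ∀ G → G ≈ ⟦ G ⟧
  ≈-refl G = All.universal (λ _ → refl) ys

  ++-≈ : ∀ {G H Γ Δ} → G ≈ Γ → H ≈ Δ → G ++ H ≈ (λ y → Γ y ++ Δ y)
  ++-≈ {G} {H} G≈Γ H≈Δ =
    All.zipWith (λ {y} (e , f) → trans (⟦⟧-++ G H y) (cong₂ _++_ e f)) (G≈Γ , H≈Δ)

  transpose : ℕ → (Y → Context) → List (Y → Formula)
  transpose zero    Γ = []
  transpose (suc n) Γ = head₀ ∘ Γ ∷ transpose n (drop 1 ∘ Γ)

  transpose-correct : ∀ n Γ y → length (Γ y) ≡ n → ⟦ transpose n Γ ⟧ y ≡ Γ y
  transpose-correct zero    Γ y e with Γ y
  ... | [] = refl
  transpose-correct (suc n) Γ y e =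
    trans (cong (head₀ (Γ y) ∷_)
                (transpose-correct n (drop 1 ∘ Γ) y (trans (length-drop 1 (Γ y)) (cong (_∸ 1) e))))
          (head₀-∷-drop (Γ y) e)
    where
    head₀-∷-drop : ∀ xs → length xs ≡ suc n → head₀ xs ∷ drop 1 xs ≡ xs
    head₀-∷-drop (x ∷ xs) _ = refl

  transpose-≈ : ∀ {n Γ} → All (λ y → length (Γ y) ≡ n) ys → transpose n Γ ≈ Γ
  transpose-≈ {n} {Γ} = All.map (λ {y} → transpose-correct n Γ y)

  module Coercions (S : AtomList → Set) where

    transposed : ∀ {G Γ φ} → G ≈ Γ → S (map (λ y → Γ y , φ y) ys) → S (G ⊢ φ)
    transposed G≈Γ = subst S (map-cong-local (All.map (λ e → cong (_, _) (sym e)) G≈Γ))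

    untransposed : ∀ {G Γ φ} → G ≈ Γ → S (G ⊢ φ) → S (map (λ y → Γ y , φ y) ys)
    untransposed G≈Γ = subst S (map-cong-local (All.map (λ e → cong (_, _) e) G≈Γ))

    split : ∀ G H {φ} → S (G ++ H ⊢ φ) → S (map (λ y → ⟦ G ⟧ y ++ ⟦ H ⟧ y , φ y) ys)
    split G H = untransposed (++-≈ (≈-refl G) (≈-refl H))

    join : ∀ G H {φ} → S (map (λ y → ⟦ G ⟧ y ++ ⟦ H ⟧ y , φ y) ys) → S (G ++ H ⊢ φ)
    join G H = transposed (++-≈ (≈-refl G) (≈-refl H))

    recast : ∀ {G H φ} → G ≡ H → S (G ⊢ φ) → S (H ⊢ φ)
    recast {φ = φ} = subst (λ K → S (K ⊢ φ))

    reindex : ∀ {X : Set} {f : X → Atom} {g : Y → X} → S (map (f ∘ g) ys) → S (map f (map g ys))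
    reindex = subst S (map-∘ ys)

    unindex : ∀ {X : Set} {f : X → Atom} {g : Y → X} → S (map f (map g ys)) → S (map (f ∘ g) ys)
    unindex = subst S (sym (map-∘ ys))

  module Structural (S : AtomList → Set)
    (ax : (αs : List Formula) → S (map (λ α → [ α ] , α) αs))
    (W : (xs : List (Context × Formula × Formula)) →
         S (map (λ { (Γ , α , β) → Γ , β }) xs) → S (map (λ { (Γ , α , β) → Γ ++ [ α ] , β }) xs))
    (X : (xs : List (Context × Formula × Formula × Context × Formula)) →
         S (map (λ { (Γ , β , α , Δ , γ) → Γ ++ β ∷ α ∷ Δ , γ }) xs) →
         S (map (λ { (Γ , β , α , Δ , γ) → Γ ++ α ∷ β ∷ Δ , γ }) xs))
    where
    open Coercions S

    ax′ : ∀ {σ} → S ([ σ ] ⊢ σ)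
    ax′ {σ} = unindex (ax (map σ ys))

    W′ : ∀ {G σ τ} → S (G ⊢ τ) → S (G ++ [ σ ] ⊢ τ)
    W′ {G} {σ} {τ} d = join G [ σ ] (unindex (W (map (λ y → ⟦ G ⟧ y , σ y , τ y) ys) (reindex d)))

    X′ : ∀ {G H σ τ ρ} → S (G ++ τ ∷ σ ∷ H ⊢ ρ) → S (G ++ σ ∷ τ ∷ H ⊢ ρ)
    X′ {G} {H} {σ} {τ} {ρ} d =
      join G (σ ∷ τ ∷ H)
        (unindex (X (map (λ y → ⟦ G ⟧ y , τ y , σ y , ⟦ H ⟧ y , ρ y) ys) (reindex (split G _ d))))

    weaken : ∀ {G} H {φ} → S (G ⊢ φ) → S (G ++ H ⊢ φ)
    weaken {G} []      d = recast (sym (++-identityʳ G)) d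
    weaken {G} (h ∷ H) d = recast (++-assoc G [ h ] H) (weaken H (W′ d))

    shift : ∀ K H {g Q φ} → S (K ++ g ∷ H ++ Q ⊢ φ) → S (K ++ H ++ g ∷ Q ⊢ φ)
    shift K []      d = d
    shift K (h ∷ H) d =
      recast (++-assoc K [ h ] _) (shift (K ++ [ h ]) H (recast (sym (++-assoc K [ h ] _)) (X′ {G = K} d)))

module NaturalDeduction {Y : Set} (ys : List Y) where
  open Family ys
  open Coercions ISL
  open Structural ISL ISL.ax ISL.W ISL.X

  ⇒I′ : ∀ {G σ τ} → ISL (G ++ [ σ ] ⊢ τ) → ISL (G ⊢ σ ⇒̇ τ)
  ⇒I′ {G} {σ} {τ} d = unindex (⇒I (map (λ y → ⟦ G ⟧ y , σ y , τ y) ys) (reindex (split G [ σ ] d)))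

  ⇒E′ : ∀ {G σ τ} → ISL (G ⊢ σ ⇒̇ τ) → ISL (G ⊢ σ) → ISL (G ⊢ τ)
  ⇒E′ {G} {σ} {τ} d e = unindex (⇒E (map (λ y → ⟦ G ⟧ y , σ y , τ y) ys) (reindex d) (reindex e))

  ∧I′ : ∀ {G σ τ} → ISL (G ⊢ σ) → ISL (G ⊢ τ) → ISL (G ⊢ σ ∧̇ τ)
  ∧I′ {G} {σ} {τ} d e = unindex (∧I (map (λ y → ⟦ G ⟧ y , σ y , τ y) ys) (reindex d) (reindex e))

  ∧EL′ : ∀ {G σ τ} → ISL (G ⊢ σ ∧̇ τ) → ISL (G ⊢ σ)
  ∧EL′ {G} {σ} {τ} d = unindex (∧EL (map (λ y → ⟦ G ⟧ y , σ y , τ y) ys) (reindex d))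

  ∧ER′ : ∀ {G σ τ} → ISL (G ⊢ σ ∧̇ τ) → ISL (G ⊢ τ)
  ∧ER′ {G} {σ} {τ} d = unindex (∧ER (map (λ y → ⟦ G ⟧ y , σ y , τ y) ys) (reindex d))

  assumption : ∀ {g G} → g ∈ G → ISL (G ⊢ g)
  assumption g∈G with Before , After , refl ← ∈-∃++ g∈G = shift [] Before (weaken (Before ++ After) ax′)

  assumptions : ∀ {G Δ} → G ⊆ Δ → All (λ g → ISL (Δ ⊢ g)) G
  assumptions G⊆Δ = All.tabulate (λ g∈G → assumption (G⊆Δ g∈G))

  infixr 6 _⇒*_
  _⇒*_ : List (Y → Formula) → (Y → Formula) → Y → Formula
  G ⇒* τ = foldr _⇒̇_ τ G

  close : ∀ K G {τ} → ISL (K ++ G ⊢ τ) → ISL (K ⊢ G ⇒* τ)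
  close K []      d = recast (++-identityʳ K) d
  close K (g ∷ G) d = ⇒I′ (close (K ++ [ g ]) G (recast (sym (++-assoc K [ g ] G)) d))

  discharge : ∀ {Δ G τ} → ISL (Δ ⊢ G ⇒* τ) → All (λ g → ISL (Δ ⊢ g)) G → ISL (Δ ⊢ τ)
  discharge d []       = d
  discharge d (e ∷ es) = discharge (⇒E′ d e) es

  substitute : ∀ {G Δ τ} → ISL (G ⊢ τ) → All (λ g → ISL (Δ ⊢ g)) G → ISL (Δ ⊢ τ)
  substitute {G} {Δ} d = discharge (weaken Δ (close [] G d))

  rename : ∀ {G Δ τ} → G ⊆ Δ → ISL (G ⊢ τ) → ISL (Δ ⊢ τ)
  rename G⊆Δ d = substitute d (assumptions G⊆Δ)

  cut-last : ∀ {H g new τ} → ISL (H ++ [ g ] ⊢ τ) → ISL (H ++ [ new ] ⊢ g) → ISL (H ++ [ new ] ⊢ τ)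
  cut-last d e = substitute d (++⁺ (assumptions ∈-++⁺ˡ) (e ∷ []))

  cutᴺ : ∀ {Γ Δ α β} → ISL (Γ ⊢ α) → ISL (Δ ++ [ α ] ⊢ β) → ISL (Γ ++ Δ ⊢ β)
  cutᴺ {Γ} {Δ} d e = substitute e (++⁺ (assumptions (xs⊆ys++xs Δ Γ)) (rename (xs⊆xs++ys Γ Δ) d ∷ []))

  contractᴺ : ∀ {Γ α β} → ISL (Γ ++ α ∷ α ∷ [] ⊢ β) → ISL (Γ ++ [ α ] ⊢ β)
  contractᴺ {Γ} = rename (⊆.++⁺ʳ Γ (∈-∷⁺ʳ (here refl) ⊆-refl))

  ⇒Lᴺ : ∀ {Γ Δ α β γ} →
        ISL (Γ ⊢ α) → ISL (Δ ++ [ β ] ⊢ γ) → ISL (Γ ++ Δ ++ [ α ⇒̇ β ] ⊢ γ)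
  ⇒Lᴺ {Γ} {Δ} d e =
    substitute e
      (++⁺ (assumptions (∈-++⁺ʳ Γ ∘ ∈-++⁺ˡ))
           (⇒E′ (assumption (∈-++⁺ʳ Γ (∈-++⁺ʳ Δ (here refl)))) (rename ∈-++⁺ˡ d) ∷ []))

  ∧Lᴺ : ∀ {Γ αL αR β} → ISL (Γ ++ αL ∷ αR ∷ [] ⊢ β) → ISL (Γ ++ [ αL ∧̇ αR ] ⊢ β)
  ∧Lᴺ {Γ} {αL} {αR} d =
    substitute d (++⁺ (assumptions ∈-++⁺ˡ) (∧EL′ conjunction ∷ ∧ER′ conjunction ∷ []))
    where
    conjunction : ISL (Γ ++ [ αL ∧̇ αR ] ⊢ αL ∧̇ αR)
    conjunction = assumption (∈-++⁺ʳ Γ (here refl))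

  ∧Rᴺ : ∀ {Γ Δ α β} → ISL (Γ ⊢ α) → ISL (Δ ⊢ β) → ISL (Γ ++ Δ ⊢ α ∧̇ β)
  ∧Rᴺ {Γ} d e = ∧I′ (rename ∈-++⁺ˡ d) (rename (∈-++⁺ʳ Γ) e)

  columns : ∀ {Γ : Y → Context} {φ : Y → Formula} →
            ISL (map (λ y → Γ y , φ y) ys) → ∃[ G ] G ≈ Γ
  columns d with n , u ← ISL-uniform d = transpose n _ , transpose-≈ (map⁻ u)

  prefix-columns : ∀ {Γ : Y → Context} {φ : Y → Formula} E →
                   ISL (map (λ y → Γ y ++ ⟦ E ⟧ y , φ y) ys) → ∃[ G ] G ≈ Γ
  prefix-columns {Γ} E d with n , u ← ISL-uniform d =
    transpose (n ∸ length E) Γ ,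
    transpose-≈ (All.map (λ {y} e → trans (length-++⁻ (Γ y) _ e) (cong (n ∸_) (length-map _ E))) (map⁻ u))

  cut-admissible : ∀ {Γ Δ : Y → Context} {α β : Y → Formula} →
                   ISL (map (λ y → Γ y , α y) ys) → ISL (map (λ y → Δ y ++ [ α y ] , β y) ys) →
                   ISL (map (λ y → Γ y ++ Δ y , β y) ys)
  cut-admissible {α = α} d e with _ , G≈ ← columns d | _ , H≈ ← prefix-columns [ α ] e =
    untransposed (++-≈ G≈ H≈) (cutᴺ (transposed G≈ d) (transposed (++-≈ H≈ (≈-refl [ α ])) e))

  contraction-admissible : ∀ {Γ : Y → Context} {α β : Y → Formula} →
                           ISL (map (λ y → Γ y ++ α y ∷ α y ∷ [] , β y) ys) →
                           ISL (map (λ y → Γ y ++ [ α y ] , β y) ys)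
  contraction-admissible {α = α} d with _ , G≈ ← prefix-columns (α ∷ α ∷ []) d =
    untransposed (++-≈ G≈ (≈-refl [ α ]))
      (contractᴺ (transposed (++-≈ G≈ (≈-refl (α ∷ α ∷ []))) d))

  ⇒L-admissible : ∀ {Γ Δ : Y → Context} {α β γ : Y → Formula} →
                  ISL (map (λ y → Γ y , α y) ys) → ISL (map (λ y → Δ y ++ [ β y ] , γ y) ys) →
                  ISL (map (λ y → Γ y ++ Δ y ++ [ α y ⇒ β y ] , γ y) ys)
  ⇒L-admissible {α = α} {β} d e with _ , G≈ ← columns d | _ , H≈ ← prefix-columns [ β ] e =
    untransposed (++-≈ G≈ (++-≈ H≈ (≈-refl [ α ⇒̇ β ])))
      (⇒Lᴺ (transposed G≈ d) (transposed (++-≈ H≈ (≈-refl [ β ])) e))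

  ∧L-admissible : ∀ {Γ : Y → Context} {αL αR β : Y → Formula} →
                  ISL (map (λ y → Γ y ++ αL y ∷ αR y ∷ [] , β y) ys) →
                  ISL (map (λ y → Γ y ++ [ αL y ∧ αR y ] , β y) ys)
  ∧L-admissible {αL = αL} {αR} d with _ , G≈ ← prefix-columns (αL ∷ αR ∷ []) d =
    untransposed (++-≈ G≈ (≈-refl [ αL ∧̇ αR ]))
      (∧Lᴺ (transposed (++-≈ G≈ (≈-refl (αL ∷ αR ∷ []))) d))

  ∧R-admissible : ∀ {Γ Δ : Y → Context} {α β : Y → Formula} →
                  ISL (map (λ y → Γ y , α y) ys) → ISL (map (λ y → Δ y , β y) ys) →
                  ISL (map (λ y → Γ y ++ Δ y , α y ∧ β y) ys)
  ∧R-admissible d e with _ , G≈ ← columns d | _ , H≈ ← columns e =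
    untransposed (++-≈ G≈ H≈) (∧Rᴺ (transposed G≈ d) (transposed H≈ e))

module SequentCalculus {Y : Set} (ys : List Y) where
  open Family ys
  open Coercions ISC
  open Structural ISC ISC.ax ISC.W ISC.X

  C′ : ∀ {G α β} → ISC (G ++ α ∷ α ∷ [] ⊢ β) → ISC (G ++ [ α ] ⊢ β)
  C′ {G} {α} {β} d =
    join G [ α ] (unindex (C (map (λ y → ⟦ G ⟧ y , α y , β y) ys) (reindex (split G _ d))))

  cut′ : ∀ {Γ Δ α β} → ISC (Γ ⊢ α) → ISC (Δ ++ [ α ] ⊢ β) → ISC (Γ ++ Δ ⊢ β)
  cut′ {Γ} {Δ} {α} {β} d e =
    join Γ Δ (unindex (cut (map (λ y → ⟦ Γ ⟧ y , ⟦ Δ ⟧ y , α y , β y) ys)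
                           (reindex d) (reindex (split Δ _ e))))

  ⇒L′ : ∀ {Γ Δ α β γ} →
        ISC (Γ ⊢ α) → ISC (Δ ++ [ β ] ⊢ γ) → ISC (Γ ++ Δ ++ [ α ⇒̇ β ] ⊢ γ)
  ⇒L′ {Γ} {Δ} {α} {β} {γ} d e =
    transposed (++-≈ (≈-refl Γ) (++-≈ (≈-refl Δ) (≈-refl [ α ⇒̇ β ])))
      (unindex (⇒L (map (λ y → ⟦ Γ ⟧ y , ⟦ Δ ⟧ y , α y , β y , γ y) ys)
                   (reindex d) (reindex (split Δ _ e))))

  ⇒R′ : ∀ {G α β} → ISC (G ++ [ α ] ⊢ β) → ISC (G ⊢ α ⇒̇ β)
  ⇒R′ {G} {α} {β} d = unindex (⇒R (map (λ y → ⟦ G ⟧ y , α y , β y) ys) (reindex (split G [ α ] d)))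

  ∧L′ : ∀ {G αL αR β} → ISC (G ++ αL ∷ αR ∷ [] ⊢ β) → ISC (G ++ [ αL ∧̇ αR ] ⊢ β)
  ∧L′ {G} {αL} {αR} {β} d =
    join G _ (unindex (∧L (map (λ y → ⟦ G ⟧ y , αL y , αR y , β y) ys) (reindex (split G _ d))))

  ∧R′ : ∀ {Γ Δ α β} → ISC (Γ ⊢ α) → ISC (Δ ⊢ β) → ISC (Γ ++ Δ ⊢ α ∧̇ β)
  ∧R′ {Γ} {Δ} {α} {β} d e =
    join Γ Δ (unindex (∧R (map (λ y → ⟦ Γ ⟧ y , ⟦ Δ ⟧ y , α y , β y) ys) (reindex d) (reindex e)))

  S-combinator : ∀ {a b c} → ISC ([] ⊢ (a ⇒̇ b ⇒̇ c) ⇒̇ (a ⇒̇ b) ⇒̇ a ⇒̇ c)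
  S-combinator {a} {b} {c} =
    ⇒R′ (⇒R′ (⇒R′ (C′ {G = a ⇒̇ b ⇒̇ c ∷ a ⇒̇ b ∷ []}
      (X′ {G = [ a ⇒̇ b ⇒̇ c ]} (X′ {G = []} (X′ {G = [ a ]} (X′ {G = a ∷ a ⇒̇ b ∷ []}
        (cut′ {Γ = a ∷ a ⇒̇ b ∷ []} {Δ = a ∷ a ⇒̇ b ⇒̇ c ∷ []} a,a⇒b⊢b
          (cut′ {Γ = a ∷ a ⇒̇ b ⇒̇ c ∷ []} {Δ = [ b ]} a,a⇒b⇒c⊢b⇒c b,b⇒c⊢c)))))))))
    where
    a,a⇒b⊢b : ISC (a ∷ a ⇒̇ b ∷ [] ⊢ b)
    a,a⇒b⊢b = ⇒L′ {Γ = [ a ]} {Δ = []} ax′ ax′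
    b,b⇒c⊢c : ISC (b ∷ b ⇒̇ c ∷ [] ⊢ c)
    b,b⇒c⊢c = ⇒L′ {Γ = [ b ]} {Δ = []} ax′ ax′
    a,a⇒b⇒c⊢b⇒c : ISC (a ∷ a ⇒̇ b ⇒̇ c ∷ [] ⊢ b ⇒̇ c)
    a,a⇒b⇒c⊢b⇒c = ⇒L′ {Γ = [ a ]} {Δ = []} ax′ ax′

  pairing : ∀ {σ τ} → ISC ([] ⊢ σ ⇒̇ τ ⇒̇ σ ∧̇ τ)
  pairing {σ} {τ} = ⇒R′ {G = []} (⇒R′ {G = [ σ ]} (∧R′ {Γ = [ σ ]} {Δ = [ τ ]} ax′ ax′))

  -- ⇒R moves the last hypothesis x into both premises, the S combinator recombines them, and a cut
  -- against x , x ⇒ τ ⊢ τ puts x back.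
  modus-ponens : ∀ {G σ τ} → Reverse G → ISC (G ⊢ σ ⇒̇ τ) → ISC (G ⊢ σ) → ISC (G ⊢ τ)
  modus-ponens []             d e = cut′ {Γ = []} {Δ = []} d (⇒L′ {Γ = []} {Δ = []} e ax′)
  modus-ponens (G ∶ rs ∶ʳ x) d e =
    cut′ {Δ = [ x ]} (modus-ponens rs (modus-ponens rs (weaken G S-combinator) (⇒R′ d)) (⇒R′ e))
                     (⇒L′ {Γ = [ x ]} {Δ = []} ax′ ax′)

  ⇒Eˢ : ∀ {G σ τ} → ISC (G ⊢ σ ⇒̇ τ) → ISC (G ⊢ σ) → ISC (G ⊢ τ)
  ⇒Eˢ {G} = modus-ponens (reverseView G)

  ∧Iˢ : ∀ {G σ τ} → ISC (G ⊢ σ) → ISC (G ⊢ τ) → ISC (G ⊢ σ ∧̇ τ)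
  ∧Iˢ {G} d e = ⇒Eˢ (⇒Eˢ (weaken G pairing) d) e

  ∧ELˢ : ∀ {G σ τ} → ISC (G ⊢ σ ∧̇ τ) → ISC (G ⊢ σ)
  ∧ELˢ {G} d = recast (++-identityʳ G) (cut′ {Δ = []} d (∧L′ {G = []} (W′ ax′)))

  ∧ERˢ : ∀ {G σ τ} → ISC (G ⊢ σ ∧̇ τ) → ISC (G ⊢ τ)
  ∧ERˢ {G} d =
    recast (++-identityʳ G) (cut′ {Δ = []} d (∧L′ {G = []} (X′ {G = []} {H = []} (W′ ax′))))

  ⇒E-admissible : ∀ {n} {Γ : Y → Context} {σ τ : Y → Formula} → All (λ y → length (Γ y) ≡ n) ys →
                  ISC (map (λ y → Γ y , σ y ⇒ τ y) ys) → ISC (map (λ y → Γ y , σ y) ys) →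
                  ISC (map (λ y → Γ y , τ y) ys)
  ⇒E-admissible u d e =
    let G≈ = transpose-≈ u in untransposed G≈ (⇒Eˢ (transposed G≈ d) (transposed G≈ e))

  ∧I-admissible : ∀ {n} {Γ : Y → Context} {σ τ : Y → Formula} → All (λ y → length (Γ y) ≡ n) ys →
                  ISC (map (λ y → Γ y , σ y) ys) → ISC (map (λ y → Γ y , τ y) ys) →
                  ISC (map (λ y → Γ y , σ y ∧ τ y) ys)
  ∧I-admissible u d e =
    let G≈ = transpose-≈ u in untransposed G≈ (∧Iˢ (transposed G≈ d) (transposed G≈ e))

  ∧EL-admissible : ∀ {n} {Γ : Y → Context} {σ τ : Y → Formula} → All (λ y → length (Γ y) ≡ n) ys →
                   ISC (map (λ y → Γ y , σ y ∧ τ y) ys) → ISC (map (λ y → Γ y , σ y) ys)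
  ∧EL-admissible u d = let G≈ = transpose-≈ u in untransposed G≈ (∧ELˢ (transposed G≈ d))

  ∧ER-admissible : ∀ {n} {Γ : Y → Context} {σ τ : Y → Formula} → All (λ y → length (Γ y) ≡ n) ys →
                   ISC (map (λ y → Γ y , σ y ∧ τ y) ys) → ISC (map (λ y → Γ y , τ y) ys)
  ∧ER-admissible u d = let G≈ = transpose-≈ u in untransposed G≈ (∧ERˢ (transposed G≈ d))

-- Indexing by `Maybe Atom` singles out the active atom as `nothing`; its last hypothesis is then
-- replaced by cut-last, whose second premise is ∩E applied to the new hypothesis.
∩L-admissible : ∀ M Γ αL αR αX β →
                (∀ K Γ′ → ISL (K ++ [ Γ′ , αL ∩ αR ]) → ISL (K ++ [ Γ′ , αX ])) →
                ISL (M ++ [ Γ ++ [ αX ] , β ]) → ISL (M ++ [ Γ ++ [ αL ∩ αR ] , β ])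
∩L-admissible M Γ αL αR αX β ∩E-last d =
  via-columns (initLast (transpose n (context αX))) (transpose-≈ lengths)
  where
  ys : List (Maybe Atom)
  ys = map just M ++ [ nothing ]
  open Family ys
  open Coercions ISL
  open NaturalDeduction ys

  context : Formula → Maybe Atom → Context
  context x (just (Δ , _)) = Δ
  context x nothing        = Γ ++ [ x ]

  goal : Maybe Atom → Formula
  goal (just (_ , φ)) = φ
  goal nothing        = β

  indexed : ∀ (c : Maybe Atom → Context) (φ : Maybe Atom → Formula) →
            map (λ y → c y , φ y) ys ≡ map (λ a → c (just a) , φ (just a)) M ++ [ c nothing , φ nothing ]
  indexed c φ = map-∘-∷ʳ (λ y → c y , φ y) just M nothing

  family : ∀ x → map (λ y → context x y , goal y) ys ≡ M ++ [ Γ ++ [ x ] , β ]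
  family x = trans (indexed (context x) goal) (cong (_++ _) (map-id M))

  n : ℕ
  n = proj₁ (ISL-uniform d)

  lengths : All (λ y → length (context αX y) ≡ n) ys
  lengths = map⁻ (subst (ContextLength n) (sym (family αX)) (proj₂ (ISL-uniform d)))

  via-columns : ∀ {T} → InitLast T → T ≈ context αX → ISL (M ++ [ Γ ++ [ αL ∩ αR ] , β ])
  via-columns [] T≈ with ++-conicalʳ Γ [ αX ] (sym (All.head (++⁻ʳ (map just M) T≈)))
  ... | ()
  via-columns (H ∷ʳ′ g) T≈ =
    subst ISL (family (αL ∩ αR))
      (untransposed H,new≈ (cut-last (transposed T≈ (subst ISL (sym (family αX)) d)) replaced))
    where
    last-column : ⟦ H ⟧ nothing ++ [ g nothing ] ≡ Γ ++ [ αX ]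
    last-column = trans (sym (⟦⟧-++ H [ g ] nothing)) (All.head (++⁻ʳ (map just M) T≈))

    H-at-nothing : ⟦ H ⟧ nothing ≡ Γ
    H-at-nothing = proj₁ (∷ʳ-injective _ _ last-column)

    g-at-nothing : g nothing ≡ αX
    g-at-nothing = proj₂ (∷ʳ-injective _ _ last-column)

    new : Maybe Atom → Formula
    new (just a) = g (just a)
    new nothing  = αL ∩ αR

    new-agrees : ∀ a → ⟦ H ++ [ new ] ⟧ (just a) ≡ ⟦ H ++ [ g ] ⟧ (just a)
    new-agrees a = trans (⟦⟧-++ H [ new ] (just a)) (sym (⟦⟧-++ H [ g ] (just a)))

    H,new≈ : H ++ [ new ] ≈ context (αL ∩ αR)
    H,new≈ =
      ++⁺ (map⁺ (All.map (λ {a} → trans (new-agrees a)) (map⁻ (++⁻ˡ (map just M) T≈))))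
          (trans (⟦⟧-++ H [ new ] nothing) (cong (_++ [ αL ∩ αR ]) H-at-nothing) ∷ [])

    others : AtomList
    others = map (λ a → ⟦ H ++ [ new ] ⟧ (just a) , g (just a)) M

    replaced : ISL (H ++ [ new ] ⊢ g)
    replaced =
      subst ISL (sym (indexed ⟦ H ++ [ new ] ⟧ g))
        (subst (λ φ → ISL (others ++ [ ⟦ H ++ [ new ] ⟧ nothing , φ ])) (sym g-at-nothing)
          (∩E-last others _
            (subst ISL (indexed ⟦ H ++ [ new ] ⟧ new) (assumption (∈-++⁺ʳ H (here refl))))))

∩E-admissible : ∀ M Γ σL σR σX →
                (∀ K → ISC (K ++ [ [ σX ] , σX ]) → ISC (K ++ [ [ σL ∩ σR ] , σX ])) →
                ISC (M ++ [ Γ , σL ∩ σR ]) → ISC (M ++ [ Γ , σX ])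
∩E-admissible M Γ σL σR σX ∩L-last d =
  subst ISC conclusion
    (cut xs (subst ISC (sym (trans (map-∘-∷ʳ _ _ M _) (cong (_++ _) (map-id M)))) d)
            (subst ISC (sym (map-∘-∷ʳ _ _ M _))
              (∩L-last _ (subst ISC (map-∘-∷ʳ _ proj₂ M σX) (ax (map proj₂ M ++ [ σX ]))))))
  where
  xs : List (Context × Context × Formula × Formula)
  xs = map (λ (Δ , φ) → Δ , [] , φ , φ) M ++ [ Γ , [] , σL ∩ σR , σX ]

  conclusion : map (λ { (Γ , Δ , α , β) → Γ ++ Δ , β }) xs ≡ M ++ [ Γ , σX ]
  conclusion =
    trans (map-∘-∷ʳ _ _ M _)
          (cong₂ (λ N Γ′ → N ++ [ Γ′ , σX ])
                 (trans (map-cong (λ (Δ , φ) → cong (_, φ) (++-identityʳ Δ)) M) (map-id M))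
                 (++-identityʳ Γ))

permute : ∀ {L L′} → L ↭ L′ → ISL L → ISL L′
permute {L′ = L′} p = P L′ [] (↭-trans p (↭-reflexive (sym (++-identityʳ L′))))

interchange : ∀ (K L M N : AtomList) → (K ++ L) ++ (M ++ N) ↭ (K ++ M) ++ (L ++ N)
interchange K L M N =
  ↭-trans (Perm.++-assoc K L (M ++ N))
          (↭-trans (Perm.++⁺ˡ K (Perm.shifts L M)) (↭-sym (Perm.++-assoc K M (L ++ N))))

swap-last : ∀ (K A B : AtomList) → (K ++ A) ++ B ↭ (K ++ B) ++ A
swap-last K A B =
  ↭-trans (Perm.++-assoc K A B) (↭-trans (Perm.++⁺ˡ K (Perm.++-comm A B)) (↭-sym (Perm.++-assoc K B A)))

merge-copies : ∀ {X : Set} {f : X → Atom} xs → ISL (map f xs ++ map f xs) → ISL (map f (xs ++ xs))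
merge-copies xs = subst ISL (sym (map-++ _ xs xs))

split-copies : ∀ {X : Set} {f : X → Atom} xs → ISL (map f (xs ++ xs)) → ISL (map f xs ++ map f xs)
split-copies xs = subst ISL (map-++ _ xs xs)

duplicate-local : ∀ {A B} → (∀ K → ISL (K ++ A) → ISL (K ++ B)) →
                  ∀ M → ISL ((M ++ A) ++ (M ++ A)) → ISL ((M ++ B) ++ (M ++ B))
duplicate-local {A} {B} rule M d =
  permute (interchange M M B B)
    (subst ISL (++-assoc (M ++ M) B B)
      (rule ((M ++ M) ++ B) (permute (swap-last (M ++ M) A B)
        (rule ((M ++ M) ++ A) (subst ISL (sym (++-assoc (M ++ M) A A)) (permute (interchange M A M A) d))))))

duplicate : ∀ {L} → ISL L → ISL (L ++ L)
duplicate (ax σs)           = subst ISL (map-++ _ σs σs) (ax (σs ++ σs))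
duplicate (P M N p d)       = P (M ++ M) (N ++ N) (↭-trans (Perm.++⁺ p p) (interchange M N M N)) (duplicate d)
duplicate (W xs d)          = split-copies xs (W (xs ++ xs) (merge-copies xs (duplicate d)))
duplicate (X xs d)          = split-copies xs (X (xs ++ xs) (merge-copies xs (duplicate d)))
duplicate (⇒I xs d)         = split-copies xs (⇒I (xs ++ xs) (merge-copies xs (duplicate d)))
duplicate (⇒E xs d e)       =
  split-copies xs (⇒E (xs ++ xs) (merge-copies xs (duplicate d)) (merge-copies xs (duplicate e)))
duplicate (∧I xs d e)       =
  split-copies xs (∧I (xs ++ xs) (merge-copies xs (duplicate d)) (merge-copies xs (duplicate e)))
duplicate (∧EL xs d)        = split-copies xs (∧EL (xs ++ xs) (merge-copies xs (duplicate d)))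
duplicate (∧ER xs d)        = split-copies xs (∧ER (xs ++ xs) (merge-copies xs (duplicate d)))
duplicate (∩I M Γ σ τ d)    = duplicate-local (λ K → ∩I K Γ σ τ) M (duplicate d)
duplicate (∩EL M Γ σL σR d) = duplicate-local (λ K → ∩EL K Γ σL σR) M (duplicate d)
duplicate (∩ER M Γ σL σR d) = duplicate-local (λ K → ∩ER K Γ σL σR) M (duplicate d)

fusion-admissible : ∀ M Γ β → ISL (M ++ [ Γ , β ]) → ISL (M ++ (Γ , β) ∷ (Γ , β) ∷ [])
fusion-admissible M Γ β d = P (M ++ a ∷ a ∷ []) M two-copies (duplicate d)
  where
  a : Atom
  a = Γ , β

  two-copies : (M ++ [ a ]) ++ (M ++ [ a ]) ↭ (M ++ a ∷ a ∷ []) ++ M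
  two-copies =
    ↭-trans (Perm.++⁺ˡ (M ++ [ a ]) (Perm.++-comm M [ a ]))
            (↭-reflexive (trans (sym (++-assoc (M ++ [ a ]) [ a ] M)) (cong (_++ M) (++-assoc M [ a ] [ a ]))))

ISC⇒ISL : ∀ {L} → ISC L → ISL L
ISC⇒ISL (ax αs)             = ax αs
ISC⇒ISL (cut xs d e)        = NaturalDeduction.cut-admissible xs (ISC⇒ISL d) (ISC⇒ISL e)
ISC⇒ISL (W xs d)            = W xs (ISC⇒ISL d)
ISC⇒ISL (X xs d)            = X xs (ISC⇒ISL d)
ISC⇒ISL (C xs d)            = NaturalDeduction.contraction-admissible xs (ISC⇒ISL d)
ISC⇒ISL (Fus M Γ β d)       = fusion-admissible M Γ β (ISC⇒ISL d)
ISC⇒ISL (P M N p d)         = P M N p (ISC⇒ISL d)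
ISC⇒ISL (⇒L xs d e)         = NaturalDeduction.⇒L-admissible xs (ISC⇒ISL d) (ISC⇒ISL e)
ISC⇒ISL (⇒R xs d)           = ⇒I xs (ISC⇒ISL d)
ISC⇒ISL (∧L xs d)           = NaturalDeduction.∧L-admissible xs (ISC⇒ISL d)
ISC⇒ISL (∧R xs d e)         = NaturalDeduction.∧R-admissible xs (ISC⇒ISL d) (ISC⇒ISL e)
ISC⇒ISL (∩LL M Γ αL αR β d) = ∩L-admissible M Γ αL αR αL β (λ K Γ′ → ∩EL K Γ′ αL αR) (ISC⇒ISL d)
ISC⇒ISL (∩LR M Γ αL αR β d) = ∩L-admissible M Γ αL αR αR β (λ K Γ′ → ∩ER K Γ′ αL αR) (ISC⇒ISL d)
ISC⇒ISL (∩R M Γ α β d)      = ∩I M Γ α β (ISC⇒ISL d)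

ISL⇒ISC : ∀ {L} → ISL L → ISC L
ISL⇒ISC (ax σs)           = ax σs
ISL⇒ISC (P M N p d)       = P M N p (ISL⇒ISC d)
ISL⇒ISC (W xs d)          = W xs (ISL⇒ISC d)
ISL⇒ISC (X xs d)          = X xs (ISL⇒ISC d)
ISL⇒ISC (⇒I xs d)         = ⇒R xs (ISL⇒ISC d)
ISL⇒ISC (⇒E xs d e)       =
  SequentCalculus.⇒E-admissible xs (map⁻ (proj₂ (ISL-uniform d))) (ISL⇒ISC d) (ISL⇒ISC e)
ISL⇒ISC (∧I xs d e)       =
  SequentCalculus.∧I-admissible xs (map⁻ (proj₂ (ISL-uniform d))) (ISL⇒ISC d) (ISL⇒ISC e)
ISL⇒ISC (∧EL xs d)        = SequentCalculus.∧EL-admissible xs (map⁻ (proj₂ (ISL-uniform d))) (ISL⇒ISC d)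
ISL⇒ISC (∧ER xs d)        = SequentCalculus.∧ER-admissible xs (map⁻ (proj₂ (ISL-uniform d))) (ISL⇒ISC d)
ISL⇒ISC (∩I M Γ σ τ d)    = ∩R M Γ σ τ (ISL⇒ISC d)
ISL⇒ISC (∩EL M Γ σL σR d) = ∩E-admissible M Γ σL σR σL (λ K → ∩LL K [] σL σR σL) (ISL⇒ISC d)
ISL⇒ISC (∩ER M Γ σL σR d) = ∩E-admissible M Γ σL σR σR (λ K → ∩LR K [] σL σR σR) (ISL⇒ISC d)

theorem2p2 : (M : AtomList) → IsMolecule M → (ISL M → ISC M) × (ISC M → ISL M)
theorem2p2 M _ = ISL⇒ISC , ISC⇒ISL
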